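{- Let $\Gamma$ be a finite, simple, connected graph of diameter $2$. Then $\Gamma$ is $2$-distance-balanced if and only if $\Gamma = \Gamma_1 + \Gamma_2 + \cdots + \Gamma_t$ for some $t \ge 1$, where each $\Gamma_i$ is a regular graph.
   Context: The join $\Gamma_1 + \Gamma_2$ of graphs with disjoint vertex sets is the disjoint union of $\Gamma_1$ and $\Gamma_2$ together with all edges joining a vertex of $\Gamma_1$ to a vertex of $\Gamma_2$; the join is commutative and associative, so $\Gamma_1 + \cdots + \Gamma_t$ is well defined (for $t=1$ it is just $\Gamma_1$). For vertices $u,v$, $W_{uv} = \{w \mid d(u,w) < d(v,w)\}$. A connected graph of diameter at least $2$ is $2$-distance-balanced if $|W_{uv}| = |W_{vu}|$ for all $u,v$ with $d(u,v)=2$. -}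

module Defs where

open import Data.Nat using (ℕ; zero; suc; _+_; _≤_; _<ᵇ_)
open import Data.Fin using (Fin; zero; suc; splitAt; _≟_)
open import Data.Bool using (Bool; true; false; if_then_else_; _∧_; _∨_)
open import Data.Sum using (_⊎_; inj₁; inj₂)
open import Data.Product using (Σ; ∃; ∃-syntax; _×_; _,_)
open import Data.List.NonEmpty using (List⁺; _∷_)
open import Data.List using (List; []; _∷_)
open import Data.Unit using (⊤)
open import Relation.Binary.PropositionalEquality using (_≡_)
open import Relation.Nullary.Decidable using (⌊_⌋)
open import Function.Bundles using (_↔_; Inverse)

record Graph (n : ℕ) : Set where
  constructor mkGraph
  field
    adj : Fin n → Fin n → Bool
open Graph public

IsSimple : ∀ {n} → Graph n → Set
IsSimple {n} G = (∀ (u v : Fin n) → adj G u v ≡ adj G v u) × (∀ (u : Fin n) → adj G u u ≡ false)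

countF : ∀ {n} → (Fin n → Bool) → ℕ
countF {zero} p = 0
countF {suc n} p = (if p zero then 1 else 0) + countF (λ i → p (suc i))

anyF : ∀ {n} → (Fin n → Bool) → Bool
anyF {zero} p = false
anyF {suc n} p = p zero ∨ anyF (λ i → p (suc i))

degree : ∀ {n} → Graph n → Fin n → ℕ
degree G v = countF (adj G v)

IsRegular : ∀ {n} → Graph n → Set
IsRegular {n} G = ∃[ k ] (∀ (v : Fin n) → degree G v ≡ k)

reach : ∀ {n} → Graph n → ℕ → Fin n → Fin n → Bool
reach G zero u v = ⌊ u ≟ v ⌋
reach G (suc k) u v = reach G k u v ∨ anyF (λ w → adj G u w ∧ reach G k w v)

leastFrom : (ℕ → Bool) → ℕ → ℕ → ℕ
leastFrom p i zero = i
leastFrom p i (suc f) = if p i then i else leastFrom p (suc i) f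

-- distance d(u,v): least k with a walk of length ≤ k (value n if unreachable)
dist : ∀ {n} → Graph n → Fin n → Fin n → ℕ
dist {n} G u v = leastFrom (λ k → reach G k u v) 0 n

Connected : ∀ {n} → Graph n → Set
Connected {n} G = ∀ (u v : Fin n) → ∃[ k ] (reach G k u v ≡ true)

Diameter2 : ∀ {n} → Graph n → Set
Diameter2 {n} G = Connected G × (∀ (u v : Fin n) → dist G u v ≤ 2)
                  × (∃[ u ] ∃[ v ] (dist G u v ≡ 2))

Wcard : ∀ {n} → Graph n → Fin n → Fin n → ℕ
Wcard G u v = countF (λ w → dist G u w <ᵇ dist G v w)

TwoDistanceBalanced : ∀ {n} → Graph n → Set
TwoDistanceBalanced {n} G = ∀ (u v : Fin n) → dist G u v ≡ 2 → Wcard G u v ≡ Wcard G v u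

join : ∀ {m n} → Graph m → Graph n → Graph (m + n)
join {m} G H = mkGraph λ x y → go (splitAt m x) (splitAt m y)
  where
  go : _ ⊎ _ → _ ⊎ _ → Bool
  go (inj₁ a) (inj₁ b) = adj G a b
  go (inj₂ a) (inj₂ b) = adj H a b
  go (inj₁ _) (inj₂ _) = true
  go (inj₂ _) (inj₁ _) = true

SomeGraph : Set
SomeGraph = Σ ℕ Graph

joinAll : List⁺ SomeGraph → SomeGraph
joinAll (g ∷ gs) = go g gs
  where
  go : SomeGraph → List SomeGraph → SomeGraph
  go g [] = g
  go (m , G) (h ∷ hs) with go h hs
  ... | (n , H) = (m + n , join G H)

record _≅_ {m n : ℕ} (G : Graph m) (H : Graph n) : Set where
  field
    bij : Fin m ↔ Fin n
    preserves : ∀ (u v : Fin m) → adj G u v ≡ adj H (Inverse.to bij u) (Inverse.to bij v)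

AllSimpleRegular : List⁺ SomeGraph → Set
AllSimpleRegular (g ∷ gs) = P g × All′ gs
  where
  P : SomeGraph → Set
  P (_ , G) = IsSimple G × IsRegular G
  All′ : List SomeGraph → Set
  All′ [] = ⊤
  All′ (h ∷ hs) = P h × All′ hs

module Submission where

-- For non-adjacent u ≠ v in a graph of diameter 2, a vertex w ∉ {u, v} is closer to u than to v
-- exactly when it is adjacent to u but not to v, so |W_uv| + |N(u) ∩ N(v)| = deg u + 1.  Hence Γ
-- is 2-distance-balanced iff non-adjacent vertices have equal degrees.  This property holds in
-- regular graphs and is preserved by joins.  Conversely, if it holds and d is the degree of some
-- vertex, every vertex of degree d is adjacent to every vertex of another degree, so Γ is the
-- join of the regular subgraph induced on the degree-d vertices with the subgraph induced on the
-- rest, which inherits the property and is smaller.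

open import Defs
import Algebra.Properties.CommutativeSemigroup as CommutativeSemigroupProperties
open import Data.Bool using (Bool; true; false; not; _∧_; _∨_; if_then_else_)
open import Data.Bool.Properties using (∧-comm; ∧-zeroʳ; ∧-identityʳ; ∨-identityʳ; T-≡)
open import Data.Fin using (Fin; zero; suc; splitAt; _↑ˡ_; _↑ʳ_; punchIn; _≟_)
open import Data.Fin.Permutation using (Permutation; remove; punchIn-permute; _⟨$⟩ʳ_; _⟨$⟩ˡ_)
open import Data.Fin.Properties using (splitAt-↑ˡ; splitAt-↑ʳ; splitAt-join; +↔⊎)
import Data.Fin as Fin
open import Data.List using ([]; _∷_)
open import Data.List.NonEmpty using (_∷_; _∷⁺_)
open import Data.Nat using (ℕ; zero; suc; _+_; _∸_; _≤_; _<_; _≡ᵇ_; _<ᵇ_; z≤n; s≤s)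
open import Data.Nat.Induction using (<-rec)
open import Data.Nat.Properties hiding (_≟_)
open import Data.Product using (∃-syntax; _×_; _,_; proj₁; proj₂)
open import Data.Sum using (_⊎_; inj₁; inj₂; [_,_]′)
import Data.Sum as Sum
open import Data.Sum.Algebra using (⊎-cong; ⊎-assoc; ⊎-comm)
open import Data.Empty using (⊥-elim)
open import Data.Unit using (tt)
open import Level using (0ℓ)
open import Function using (_∘_; id; const)
open import Function.Bundles using (Inverse; _↔_; _⇔_; mk⇔; Equivalence)
open import Function.Properties.Inverse using (↔-refl; ↔-sym; ↔-trans)
open import Relation.Binary.PropositionalEquality
open import Relation.Nullary using (yes; no)
open import Relation.Nullary.Decidable using (⌊_⌋; ⌊⌋-map′; isYes≗does; dec-true; dec-false)

open CommutativeSemigroupProperties +-commutativeSemigroup using (interchange; x∙yz≈y∙xz)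

indicator : Bool → ℕ
indicator b = if b then 1 else 0

countF-cong : ∀ {n} {p q : Fin n → Bool} → (∀ i → p i ≡ q i) → countF p ≡ countF q
countF-cong {zero}  e = refl
countF-cong {suc n} e = cong₂ _+_ (cong indicator (e zero)) (countF-cong (e ∘ suc))

countF-true : ∀ {n} → countF {n} (const true) ≡ n
countF-true {zero}  = refl
countF-true {suc n} = cong suc (countF-true {n})

countF-≤ : ∀ {n} (p : Fin n → Bool) → countF p ≤ n
countF-≤ {zero}  p = z≤n
countF-≤ {suc n} p with p zero
... | true  = s≤s (countF-≤ (p ∘ suc))
... | false = m≤n⇒m≤1+n (countF-≤ (p ∘ suc))

countF-+-cong : ∀ {n} (p q r s : Fin n → Bool) →
  (∀ i → indicator (p i) + indicator (q i) ≡ indicator (r i) + indicator (s i)) →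
  countF p + countF q ≡ countF r + countF s
countF-+-cong {zero}  p q r s e = refl
countF-+-cong {suc n} p q r s e = begin
  (indicator (p zero) + countF (p ∘ suc)) + (indicator (q zero) + countF (q ∘ suc))
    ≡⟨ interchange (indicator (p zero)) _ _ _ ⟩
  (indicator (p zero) + indicator (q zero)) + (countF (p ∘ suc) + countF (q ∘ suc))
    ≡⟨ cong₂ _+_ (e zero) (countF-+-cong (p ∘ suc) (q ∘ suc) (r ∘ suc) (s ∘ suc) (e ∘ suc)) ⟩
  (indicator (r zero) + indicator (s zero)) + (countF (r ∘ suc) + countF (s ∘ suc))
    ≡⟨ interchange (indicator (r zero)) _ _ _ ⟨
  (indicator (r zero) + countF (r ∘ suc)) + (indicator (s zero) + countF (s ∘ suc)) ∎
  where open ≡-Reasoning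

countF-≟ : ∀ {n} (u : Fin n) → countF (λ w → ⌊ w ≟ u ⌋) ≡ 1
countF-≟ {suc n} zero    = cong suc (countF-false {n})
  where
  countF-false : ∀ {n} → countF {n} (const false) ≡ 0
  countF-false {zero}  = refl
  countF-false {suc n} = countF-false {n}
countF-≟ {suc n} (suc u) = trans (countF-cong λ i → ⌊⌋-map′ _ _ (i ≟ u)) (countF-≟ u)

countF-splitAt : ∀ {m k} (p : Fin (m + k) → Bool) →
  countF p ≡ countF (p ∘ (_↑ˡ k)) + countF (p ∘ (m ↑ʳ_))
countF-splitAt {zero}      p = refl
countF-splitAt {suc m} {k} p =
  trans (cong (indicator (p zero) +_) (countF-splitAt {m} {k} (p ∘ suc)))
        (sym (+-assoc (indicator (p zero)) _ _))

countF-punchIn : ∀ {n} (p : Fin (suc n) → Bool) (i : Fin (suc n)) →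
  countF p ≡ indicator (p i) + countF (p ∘ punchIn i)
countF-punchIn p       zero    = refl
countF-punchIn {suc n} p (suc i) =
  trans (cong (indicator (p zero) +_) (countF-punchIn (p ∘ suc) i))
        (x∙yz≈y∙xz (indicator (p zero)) (indicator (p (suc i))) _)

countF-permute : ∀ {m n} (π : Permutation m n) (p : Fin n → Bool) →
  countF (p ∘ (π ⟨$⟩ʳ_)) ≡ countF p
countF-permute {zero}  {zero}  π p = refl
countF-permute {zero}  {suc n} π p with π ⟨$⟩ˡ zero
... | ()
countF-permute {suc m} {zero}  π p with π ⟨$⟩ʳ zero
... | ()
countF-permute {suc m} {suc n} π p = begin
  indicator (p (π ⟨$⟩ʳ zero)) + countF (p ∘ (π ⟨$⟩ʳ_) ∘ suc)
    ≡⟨ cong (indicator (p (π ⟨$⟩ʳ zero)) +_) (countF-cong (cong p ∘ punchIn-permute π zero)) ⟩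
  indicator (p (π ⟨$⟩ʳ zero)) + countF (p ∘ punchIn (π ⟨$⟩ʳ zero) ∘ (remove zero π ⟨$⟩ʳ_))
    ≡⟨ cong (indicator (p (π ⟨$⟩ʳ zero)) +_) (countF-permute (remove zero π) _) ⟩
  indicator (p (π ⟨$⟩ʳ zero)) + countF (p ∘ punchIn (π ⟨$⟩ʳ zero))
    ≡⟨ countF-punchIn p (π ⟨$⟩ʳ zero) ⟨
  countF p ∎
  where open ≡-Reasoning

countF-< : ∀ {n} (p : Fin n → Bool) (i : Fin n) → p i ≡ false → countF p < n
countF-< {suc n} p i pi≡false = s≤s (begin
  countF p                                   ≡⟨ countF-punchIn p i ⟩
  indicator (p i) + countF (p ∘ punchIn i)   ≡⟨ cong (λ b → indicator b + countF (p ∘ punchIn i)) pi≡false ⟩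
  countF (p ∘ punchIn i)                     ≤⟨ countF-≤ (p ∘ punchIn i) ⟩
  n                                          ∎)
  where open ≤-Reasoning

anyF-cong : ∀ {n} {p q : Fin n → Bool} → (∀ i → p i ≡ q i) → anyF p ≡ anyF q
anyF-cong {zero}  e = refl
anyF-cong {suc n} e = cong₂ _∨_ (e zero) (anyF-cong (e ∘ suc))

anyF-false : ∀ {n} → anyF {n} (const false) ≡ false
anyF-false {zero}  = refl
anyF-false {suc n} = anyF-false {n}

anyF-∧-≟ : ∀ {n} (f : Fin n → Bool) (v : Fin n) → anyF (λ w → f w ∧ ⌊ w ≟ v ⌋) ≡ f v
anyF-∧-≟ {suc n} f zero =
  trans (cong₂ _∨_ (∧-identityʳ (f zero)) (trans (anyF-cong (∧-zeroʳ ∘ f ∘ suc)) (anyF-false {n})))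
        (∨-identityʳ (f zero))
anyF-∧-≟ f (suc v) rewrite ∧-zeroʳ (f zero) =
  trans (anyF-cong λ i → cong (f (suc i) ∧_) (⌊⌋-map′ _ _ (i ≟ v))) (anyF-∧-≟ (f ∘ suc) v)

leastFrom-true : ∀ p i f → p i ≡ true → leastFrom p i (suc f) ≡ i
leastFrom-true p i f pi≡true rewrite pi≡true = refl

leastFrom-false : ∀ p i f → p i ≡ false → leastFrom p i (suc f) ≡ leastFrom p (suc i) f
leastFrom-false p i f pi≡false rewrite pi≡false = refl

leastFrom-≥ : ∀ p i f → i ≤ leastFrom p i f
leastFrom-≥ p i zero    = ≤-refl
leastFrom-≥ p i (suc f) with p i
... | true  = ≤-refl
... | false = ≤-trans (n≤1+n i) (leastFrom-≥ p (suc i) f)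

reach-0 : ∀ {n} (G : Graph n) {u v} → u ≢ v → reach G 0 u v ≡ false
reach-0 G {u} {v} u≢v = trans (isYes≗does (u ≟ v)) (dec-false (u ≟ v) u≢v)

reach-1 : ∀ {n} (G : Graph n) {u v} → u ≢ v → reach G 1 u v ≡ adj G u v
reach-1 G {u} {v} u≢v rewrite reach-0 G u≢v = anyF-∧-≟ (adj G u) v

dist-self : ∀ {n} (G : Graph n) u → dist G u u ≡ 0
dist-self {suc n} G u = leastFrom-true _ 0 n (trans (isYes≗does (u ≟ u)) (dec-true (u ≟ u) refl))

dist-adjacent : ∀ {n} (G : Graph n) {u v} → u ≢ v → adj G u v ≡ true → dist G u v ≡ 1
dist-adjacent {suc zero}    G {zero} {zero} u≢v = ⊥-elim (u≢v refl)
dist-adjacent {suc (suc n)} G {u} {v} u≢v uv∈E =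
  trans (leastFrom-false (λ k → reach G k u v) 0 (suc n) (reach-0 G u≢v))
        (leastFrom-true (λ k → reach G k u v) 1 n (trans (reach-1 G u≢v) uv∈E))

dist-nonadjacent : ∀ {n} (G : Graph n) {u v} → u ≢ v → adj G u v ≡ false → 2 ≤ dist G u v
dist-nonadjacent {suc zero}    G {zero} {zero} u≢v = ⊥-elim (u≢v refl)
dist-nonadjacent {suc (suc n)} G {u} {v} u≢v uv∉E =
  subst (2 ≤_)
    (sym (trans (leastFrom-false (λ k → reach G k u v) 0 (suc n) (reach-0 G u≢v))
                (leastFrom-false (λ k → reach G k u v) 1 n (trans (reach-1 G u≢v) uv∉E))))
    (leastFrom-≥ (λ k → reach G k u v) 2 n)

NonAdjacentEqualDegree : ∀ {n} → Graph n → Set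
NonAdjacentEqualDegree {n} G = ∀ (u v : Fin n) → adj G u v ≡ false → degree G u ≡ degree G v

commonNeighbours : ∀ {n} → Graph n → Fin n → Fin n → ℕ
commonNeighbours G u v = countF (λ w → adj G u w ∧ adj G v w)

commonNeighbours-comm : ∀ {n} (G : Graph n) u v → commonNeighbours G u v ≡ commonNeighbours G v u
commonNeighbours-comm G u v = countF-cong λ w → ∧-comm (adj G u w) (adj G v w)

module _ {n : ℕ} (Γ : Graph n) (simple : IsSimple Γ) (diam≤2 : ∀ u v → dist Γ u v ≤ 2) where

  private
    adj-sym = proj₁ simple
    irreflexive = proj₂ simple

  dist-≢ : ∀ {u w} → u ≢ w → dist Γ u w ≡ (if adj Γ u w then 1 else 2)
  dist-≢ {u} {w} u≢w with adj Γ u w in uw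
  ... | true  = dist-adjacent Γ u≢w uw
  ... | false = ≤-antisym (diam≤2 u w) (dist-nonadjacent Γ u≢w uw)

  dist≡2⇒nonadjacent : ∀ {u v} → dist Γ u v ≡ 2 → u ≢ v × adj Γ u v ≡ false
  dist≡2⇒nonadjacent {u} {v} d≡2 = u≢v , uv∉E
    where
    u≢v : u ≢ v
    u≢v refl with trans (sym d≡2) (dist-self Γ u)
    ... | ()
    uv∉E : adj Γ u v ≡ false
    uv∉E with adj Γ u v in uv
    ... | false = refl
    ... | true with trans (sym d≡2) (dist-adjacent Γ u≢v uv)
    ...   | ()

  -- W_uv consists of u and the neighbours of u that are not neighbours of v.
  Wcard+commonNeighbours : ∀ {u v} → u ≢ v → adj Γ u v ≡ false →
    Wcard Γ u v + commonNeighbours Γ u v ≡ degree Γ u + 1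
  Wcard+commonNeighbours {u} {v} u≢v uv∉E =
    trans (countF-+-cong _ _ _ _ pointwise) (cong (degree Γ u +_) (countF-≟ u))
    where
    pointwise : ∀ w → indicator (dist Γ u w <ᵇ dist Γ v w) + indicator (adj Γ u w ∧ adj Γ v w)
                    ≡ indicator (adj Γ u w) + indicator ⌊ w ≟ u ⌋
    pointwise w with w ≟ u
    ... | yes refl
      rewrite dist-self Γ u | dist-≢ (u≢v ∘ sym) | trans (adj-sym v u) uv∉E | irreflexive u = refl
    ... | no w≢u with w ≟ v
    ... | yes refl rewrite dist-self Γ v | uv∉E = refl
    ... | no w≢v rewrite dist-≢ (w≢u ∘ sym) | dist-≢ (w≢v ∘ sym) with adj Γ u w | adj Γ v w
    ...   | true  | true  = refl
    ...   | true  | false = refl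
    ...   | false | true  = refl
    ...   | false | false = refl

  Wcard-balanced⇔degree : ∀ {u v} → u ≢ v → adj Γ u v ≡ false →
    Wcard Γ u v ≡ Wcard Γ v u ⇔ degree Γ u ≡ degree Γ v
  Wcard-balanced⇔degree {u} {v} u≢v uv∉E = mk⇔
    (λ W≡W → +-cancelʳ-≡ _ _ _ (begin
      degree Γ u + 1                          ≡⟨ countU ⟨
      Wcard Γ u v + commonNeighbours Γ u v    ≡⟨ cong (_+ commonNeighbours Γ u v) W≡W ⟩
      Wcard Γ v u + commonNeighbours Γ u v    ≡⟨ countV ⟩
      degree Γ v + 1                          ∎))
    (λ deg≡deg → +-cancelʳ-≡ _ _ _ (begin
      Wcard Γ u v + commonNeighbours Γ u v    ≡⟨ countU ⟩
      degree Γ u + 1                          ≡⟨ cong (_+ 1) deg≡deg ⟩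
      degree Γ v + 1                          ≡⟨ countV ⟨
      Wcard Γ v u + commonNeighbours Γ u v    ∎))
    where
    open ≡-Reasoning
    countU : Wcard Γ u v + commonNeighbours Γ u v ≡ degree Γ u + 1
    countU = Wcard+commonNeighbours u≢v uv∉E
    countV : Wcard Γ v u + commonNeighbours Γ u v ≡ degree Γ v + 1
    countV = trans (cong (Wcard Γ v u +_) (commonNeighbours-comm Γ u v))
                   (Wcard+commonNeighbours (u≢v ∘ sym) (trans (adj-sym v u) uv∉E))

  twoDistanceBalanced⇔nonAdjacentEqualDegree : TwoDistanceBalanced Γ ⇔ NonAdjacentEqualDegree Γ
  twoDistanceBalanced⇔nonAdjacentEqualDegree = mk⇔ to from
    where
    to : TwoDistanceBalanced Γ → NonAdjacentEqualDegree Γ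
    to balanced u v uv∉E with u ≟ v
    ... | yes refl = refl
    ... | no u≢v = Equivalence.to (Wcard-balanced⇔degree u≢v uv∉E)
                     (balanced u v (≤-antisym (diam≤2 u v) (dist-nonadjacent Γ u≢v uv∉E)))
    from : NonAdjacentEqualDegree Γ → TwoDistanceBalanced Γ
    from equalDegree u v d≡2 =
      let (u≢v , uv∉E) = dist≡2⇒nonadjacent d≡2
      in Equivalence.from (Wcard-balanced⇔degree u≢v uv∉E) (equalDegree u v uv∉E)

sumAdj : ∀ {m k} → Graph m → Graph k → Fin m ⊎ Fin k → Fin m ⊎ Fin k → Bool
sumAdj G H (inj₁ a) (inj₁ b) = adj G a b
sumAdj G H (inj₂ a) (inj₂ b) = adj H a b
sumAdj G H (inj₁ _) (inj₂ _) = true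
sumAdj G H (inj₂ _) (inj₁ _) = true

sumDegree : ∀ {m k} → Graph m → Graph k → Fin m ⊎ Fin k → ℕ
sumDegree {m} {k} G H (inj₁ a) = degree G a + k
sumDegree {m} {k} G H (inj₂ b) = m + degree H b

module _ {m k : ℕ} (G : Graph m) (H : Graph k) where

  join-adj : ∀ x y → adj (join G H) x y ≡ sumAdj G H (splitAt m x) (splitAt m y)
  join-adj x y with splitAt m x | splitAt m y
  ... | inj₁ a | inj₁ b = refl
  ... | inj₁ a | inj₂ b = refl
  ... | inj₂ a | inj₁ b = refl
  ... | inj₂ a | inj₂ b = refl

  join-adj-join : ∀ s t → adj (join G H) (Fin.join m k s) (Fin.join m k t) ≡ sumAdj G H s t
  join-adj-join s t = trans (join-adj _ _) (cong₂ (sumAdj G H) (splitAt-join m k s) (splitAt-join m k t))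

  degree-join : ∀ x → degree (join G H) x ≡ sumDegree G H (splitAt m x)
  degree-join x = begin
    degree (join G H) x
      ≡⟨ countF-splitAt {m} {k} (adj (join G H) x) ⟩
    countF (λ b → adj (join G H) x (b ↑ˡ k)) + countF (λ c → adj (join G H) x (m ↑ʳ c))
      ≡⟨ cong₂ _+_ (countF-cong λ b → trans (join-adj x _) (cong (sumAdj G H (splitAt m x)) (splitAt-↑ˡ m b k)))
                   (countF-cong λ c → trans (join-adj x _) (cong (sumAdj G H (splitAt m x)) (splitAt-↑ʳ m k c))) ⟩
    countF (sumAdj G H (splitAt m x) ∘ inj₁) + countF (sumAdj G H (splitAt m x) ∘ inj₂)
      ≡⟨ count-sides (splitAt m x) ⟩
    sumDegree G H (splitAt m x) ∎
    where
    open ≡-Reasoning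
    count-sides : ∀ s → countF (sumAdj G H s ∘ inj₁) + countF (sumAdj G H s ∘ inj₂) ≡ sumDegree G H s
    count-sides (inj₁ a) = cong (degree G a +_) countF-true
    count-sides (inj₂ b) = cong (_+ degree H b) countF-true

  join-nonAdjacentEqualDegree : NonAdjacentEqualDegree G → NonAdjacentEqualDegree H →
                                NonAdjacentEqualDegree (join G H)
  join-nonAdjacentEqualDegree equalG equalH x y xy∉E =
    trans (degree-join x)
      (trans (sides (splitAt m x) (splitAt m y) (trans (sym (join-adj x y)) xy∉E))
             (sym (degree-join y)))
    where
    sides : ∀ s t → sumAdj G H s t ≡ false → sumDegree G H s ≡ sumDegree G H t
    sides (inj₁ a) (inj₁ b) ab∉E = cong (_+ k) (equalG a b ab∉E)
    sides (inj₂ a) (inj₂ b) ab∉E = cong (m +_) (equalH a b ab∉E)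
    sides (inj₁ _) (inj₂ _) ()
    sides (inj₂ _) (inj₁ _) ()

regular⇒nonAdjacentEqualDegree : ∀ {n} (G : Graph n) → IsRegular G → NonAdjacentEqualDegree G
regular⇒nonAdjacentEqualDegree G (d , degree≡d) u v _ = trans (degree≡d u) (sym (degree≡d v))

joinAll-nonAdjacentEqualDegree : ∀ gs → AllSimpleRegular gs → NonAdjacentEqualDegree (proj₂ (joinAll gs))
joinAll-nonAdjacentEqualDegree (g ∷ gs) = go g gs
  where
  go : ∀ g gs → AllSimpleRegular (g ∷ gs) → NonAdjacentEqualDegree (proj₂ (joinAll (g ∷ gs)))
  go (_ , G) []       ((_ , regular) , _)    = regular⇒nonAdjacentEqualDegree G regular
  go (_ , G) (h ∷ hs) ((_ , regular) , rest) =
    join-nonAdjacentEqualDegree G _ (regular⇒nonAdjacentEqualDegree G regular) (go h hs rest)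

module _ {m n : ℕ} {G : Graph m} {H : Graph n} (iso : G ≅ H) where

  private
    π = _≅_.bij iso

  degree-≅ : ∀ u → degree G u ≡ degree H (Inverse.to π u)
  degree-≅ u = trans (countF-cong (_≅_.preserves iso u)) (countF-permute π (adj H (Inverse.to π u)))

  ≅-nonAdjacentEqualDegree : NonAdjacentEqualDegree H → NonAdjacentEqualDegree G
  ≅-nonAdjacentEqualDegree equalH u v uv∉E =
    trans (degree-≅ u)
      (trans (equalH _ _ (trans (sym (_≅_.preserves iso u v)) uv∉E)) (sym (degree-≅ v)))

≅-refl : ∀ {n} {G : Graph n} → G ≅ G
≅-refl = record { bij = ↔-refl ; preserves = λ _ _ → refl }

≅-trans : ∀ {m n k} {G : Graph m} {H : Graph n} {K : Graph k} → G ≅ H → H ≅ K → G ≅ K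
≅-trans G≅H H≅K = record
  { bij       = ↔-trans (_≅_.bij G≅H) (_≅_.bij H≅K)
  ; preserves = λ u v → trans (_≅_.preserves G≅H u v) (_≅_.preserves H≅K _ _)
  }

≅-join : ∀ {n m k} {Γ : Graph n} {G : Graph m} {H : Graph k} (e : Fin n ↔ (Fin m ⊎ Fin k)) →
  (∀ s t → adj Γ (Inverse.from e s) (Inverse.from e t) ≡ sumAdj G H s t) → Γ ≅ join G H
≅-join {Γ = Γ} {G} {H} e adj-from = record
  { bij       = ↔-trans e (↔-sym +↔⊎)
  ; preserves = λ u v → begin
      adj Γ u v
        ≡⟨ cong₂ (adj Γ) (Inverse.strictlyInverseʳ e u) (Inverse.strictlyInverseʳ e v) ⟨
      adj Γ (Inverse.from e (Inverse.to e u)) (Inverse.from e (Inverse.to e v))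
        ≡⟨ adj-from _ _ ⟩
      sumAdj G H (Inverse.to e u) (Inverse.to e v)
        ≡⟨ join-adj-join G H (Inverse.to e u) (Inverse.to e v) ⟨
      adj (join G H) (Fin.join _ _ (Inverse.to e u)) (Fin.join _ _ (Inverse.to e v)) ∎
  }
  where open ≡-Reasoning

join-congʳ : ∀ {m k k′} (G : Graph m) {H : Graph k} {H′ : Graph k′} → H ≅ H′ → join G H ≅ join G H′
join-congʳ {m} {k} {k′} G {H} {H′} H≅H′ = ≅-join (↔-trans +↔⊎ (⊎-cong ↔-refl π)) adj-from
  where
  π = _≅_.bij H≅H′
  back : Fin m ⊎ Fin k′ → Fin m ⊎ Fin k
  back = Sum.map id (Inverse.from π)
  sides : ∀ s t → sumAdj G H (back s) (back t) ≡ sumAdj G H′ s t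
  sides (inj₁ a) (inj₁ b) = refl
  sides (inj₁ a) (inj₂ b) = refl
  sides (inj₂ a) (inj₁ b) = refl
  sides (inj₂ a) (inj₂ b) =
    trans (_≅_.preserves H≅H′ _ _) (cong₂ (adj H′) (Inverse.strictlyInverseˡ π a) (Inverse.strictlyInverseˡ π b))
  adj-from : ∀ s t → adj (join G H) (Fin.join m k (back s)) (Fin.join m k (back t)) ≡ sumAdj G H′ s t
  adj-from s t = trans (join-adj-join G H (back s) (back t)) (sides s t)

isInj₁ : ∀ {A B : Set} → A ⊎ B → Bool
isInj₁ = [ const true , const false ]′

-- The sizes mirror one unfolding step of countF, so partition↔ below is a plain recursion.
cons↔ : ∀ {n a c} (b : Bool) → Fin n ↔ (Fin a ⊎ Fin c) →
  Fin (suc n) ↔ (Fin (indicator b + a) ⊎ Fin (indicator (not b) + c))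
cons↔ true  e =
  ↔-trans +↔⊎ (↔-trans (⊎-cong ↔-refl e) (↔-trans (↔-sym (⊎-assoc 0ℓ _ _ _)) (⊎-cong (↔-sym +↔⊎) ↔-refl)))
cons↔ false e =
  ↔-trans +↔⊎ (↔-trans (⊎-cong ↔-refl e) (↔-trans (↔-sym (⊎-assoc 0ℓ _ _ _))
    (↔-trans (⊎-cong (⊎-comm _ _) ↔-refl) (↔-trans (⊎-assoc 0ℓ _ _ _) (⊎-cong ↔-refl (↔-sym +↔⊎))))))

cons↔-classifies : ∀ {n a c} b (e : Fin n ↔ (Fin a ⊎ Fin c)) (q : Fin (suc n) → Bool) → q zero ≡ b →
  (∀ s → q (suc (Inverse.from e s)) ≡ isInj₁ s) → ∀ s → q (Inverse.from (cons↔ b e) s) ≡ isInj₁ s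
cons↔-classifies true  e q q₀ classifies (inj₁ zero)    = q₀
cons↔-classifies true  e q q₀ classifies (inj₁ (suc i)) = classifies (inj₁ i)
cons↔-classifies true  e q q₀ classifies (inj₂ j)       = classifies (inj₂ j)
cons↔-classifies false e q q₀ classifies (inj₁ i)       = classifies (inj₁ i)
cons↔-classifies false e q q₀ classifies (inj₂ zero)    = q₀
cons↔-classifies false e q q₀ classifies (inj₂ (suc j)) = classifies (inj₂ j)

partition↔ : ∀ {n} (p : Fin n → Bool) → Fin n ↔ (Fin (countF p) ⊎ Fin (countF (not ∘ p)))
partition↔ {zero}  p = +↔⊎ {0} {0}
partition↔ {suc n} p = cons↔ (p zero) (partition↔ (p ∘ suc))

partition-classifies : ∀ {n} (p : Fin n → Bool) s → p (Inverse.from (partition↔ p) s) ≡ isInj₁ s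
partition-classifies {zero}  p (inj₁ ())
partition-classifies {zero}  p (inj₂ ())
partition-classifies {suc n} p = cons↔-classifies (p zero) _ p refl (partition-classifies (p ∘ suc))

induced : ∀ {n k} → Graph n → (Fin k → Fin n) → Graph k
induced Γ f = mkGraph λ i j → adj Γ (f i) (f j)

induced-simple : ∀ {n k} {Γ : Graph n} (f : Fin k → Fin n) → IsSimple Γ → IsSimple (induced Γ f)
induced-simple f (adj-sym , irreflexive) = (λ i j → adj-sym (f i) (f j)) , (λ i → irreflexive (f i))

module Partition {n : ℕ} (Γ : Graph n) (p : Fin n → Bool) where

  embed : Fin (countF p) ⊎ Fin (countF (not ∘ p)) → Fin n
  embed = Inverse.from (partition↔ p)

  inside : Graph (countF p)
  inside = induced Γ (embed ∘ inj₁)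

  outside : Graph (countF (not ∘ p))
  outside = induced Γ (embed ∘ inj₂)

  module _ (simple : IsSimple Γ) (complete : ∀ x y → p x ≡ true → p y ≡ false → adj Γ x y ≡ true) where

    adj-embed : ∀ s t → adj Γ (embed s) (embed t) ≡ sumAdj inside outside s t
    adj-embed (inj₁ i) (inj₁ j) = refl
    adj-embed (inj₂ i) (inj₂ j) = refl
    adj-embed (inj₁ i) (inj₂ j) =
      complete _ _ (partition-classifies p (inj₁ i)) (partition-classifies p (inj₂ j))
    adj-embed (inj₂ i) (inj₁ j) =
      trans (proj₁ simple _ _) (complete _ _ (partition-classifies p (inj₁ j)) (partition-classifies p (inj₂ i)))

    ≅-join-inside-outside : Γ ≅ join inside outside
    ≅-join-inside-outside = ≅-join (partition↔ p) adj-embed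

    degree-embed : ∀ s → degree Γ (embed s) ≡ sumDegree inside outside s
    degree-embed s = begin
      degree Γ (embed s)
        ≡⟨ degree-≅ ≅-join-inside-outside (embed s) ⟩
      degree (join inside outside) (Fin.join _ _ (Inverse.to (partition↔ p) (embed s)))
        ≡⟨ degree-join inside outside _ ⟩
      sumDegree inside outside (splitAt (countF p) (Fin.join _ _ (Inverse.to (partition↔ p) (embed s))))
        ≡⟨ cong (sumDegree inside outside) (splitAt-join (countF p) (countF (not ∘ p)) (Inverse.to (partition↔ p) (embed s))) ⟩
      sumDegree inside outside (Inverse.to (partition↔ p) (embed s))
        ≡⟨ cong (sumDegree inside outside) (Inverse.strictlyInverseˡ (partition↔ p) s) ⟩
      sumDegree inside outside s ∎
      where open ≡-Reasoning

JoinOfRegular : ∀ {n} → Graph n → Set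
JoinOfRegular Γ = ∃[ gs ] (AllSimpleRegular gs × (Γ ≅ proj₂ (joinAll gs)))

≅-joinOfRegular : ∀ {m n} {G : Graph m} {H : Graph n} → G ≅ H → JoinOfRegular H → JoinOfRegular G
≅-joinOfRegular G≅H (gs , regular , H≅gs) = gs , regular , ≅-trans G≅H H≅gs

join-joinOfRegular : ∀ {m k} {G : Graph m} {H : Graph k} → IsSimple G → IsRegular G →
  JoinOfRegular H → JoinOfRegular (join G H)
join-joinOfRegular {G = G} simple regular (gs@(_ ∷ _) , regularGs , H≅gs) =
  (_ , G) ∷⁺ gs , ((simple , regular) , regularGs) , join-congʳ G H≅gs

module DegreeSplit {n : ℕ} (Γ : Graph n) (simple : IsSimple Γ) (equal : NonAdjacentEqualDegree Γ)
                   (v₀ : Fin n) where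

  hasDegree : Fin n → Bool
  hasDegree x = degree Γ x ≡ᵇ degree Γ v₀

  hasDegree⇒≡ : ∀ x → hasDegree x ≡ true → degree Γ x ≡ degree Γ v₀
  hasDegree⇒≡ x = ≡ᵇ⇒≡ _ _ ∘ Equivalence.from T-≡

  ≡⇒hasDegree : ∀ x → degree Γ x ≡ degree Γ v₀ → hasDegree x ≡ true
  ≡⇒hasDegree x = Equivalence.to T-≡ ∘ ≡⇒≡ᵇ _ _

  complete : ∀ x y → hasDegree x ≡ true → hasDegree y ≡ false → adj Γ x y ≡ true
  complete x y x∈ y∉ with adj Γ x y in xy
  ... | true  = refl
  ... | false with trans (sym (≡⇒hasDegree y (trans (sym (equal x y xy)) (hasDegree⇒≡ x x∈)))) y∉
  ...   | ()

  open Partition Γ hasDegree public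

  inside-regular : IsRegular inside
  inside-regular = degree Γ v₀ ∸ countF (not ∘ hasDegree) , λ i → begin
    degree inside i                                                     ≡⟨ m+n∸n≡m _ (countF (not ∘ hasDegree)) ⟨
    degree inside i + countF (not ∘ hasDegree) ∸ countF (not ∘ hasDegree)
      ≡⟨ cong (_∸ countF (not ∘ hasDegree)) (degree-embed simple complete (inj₁ i)) ⟨
    degree Γ (embed (inj₁ i)) ∸ countF (not ∘ hasDegree)
      ≡⟨ cong (_∸ countF (not ∘ hasDegree)) (hasDegree⇒≡ _ (partition-classifies hasDegree (inj₁ i))) ⟩
    degree Γ v₀ ∸ countF (not ∘ hasDegree)                              ∎
    where open ≡-Reasoning

  outside-nonAdjacentEqualDegree : NonAdjacentEqualDegree outside
  outside-nonAdjacentEqualDegree i j ij∉E = +-cancelˡ-≡ (countF hasDegree) _ _ (begin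
    countF hasDegree + degree outside i  ≡⟨ degree-embed simple complete (inj₂ i) ⟨
    degree Γ (embed (inj₂ i))            ≡⟨ equal _ _ ij∉E ⟩
    degree Γ (embed (inj₂ j))            ≡⟨ degree-embed simple complete (inj₂ j) ⟩
    countF hasDegree + degree outside j  ∎)
    where open ≡-Reasoning

  outside-smaller : countF (not ∘ hasDegree) < n
  outside-smaller = countF-< (not ∘ hasDegree) v₀ (cong not (≡⇒hasDegree v₀ refl))

nonAdjacentEqualDegree⇒joinOfRegular : ∀ {n} (Γ : Graph n) → IsSimple Γ → NonAdjacentEqualDegree Γ →
  JoinOfRegular Γ
nonAdjacentEqualDegree⇒joinOfRegular {n} = <-rec P step n
  where
  P : ℕ → Set
  P n = (Γ : Graph n) → IsSimple Γ → NonAdjacentEqualDegree Γ → JoinOfRegular Γ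
  step : ∀ n → (∀ {m} → m < n → P m) → P n
  -- The empty graph is regular; it also ends the list whenever all degrees are equal.
  step zero    _   Γ simple _     = ((0 , Γ) ∷ []) , ((simple , 0 , λ ()) , tt) , ≅-refl
  step (suc n) rec Γ simple equal =
    ≅-joinOfRegular (≅-join-inside-outside simple complete)
      (join-joinOfRegular (induced-simple _ simple) inside-regular
        (rec outside-smaller outside (induced-simple _ simple) outside-nonAdjacentEqualDegree))
    where open DegreeSplit Γ simple equal zero

theorem3p1 : ∀ {n : ℕ} (Γ : Graph n) → IsSimple Γ → Diameter2 Γ →
    (TwoDistanceBalanced Γ ⇔
      (∃[ gs ] (AllSimpleRegular gs × (Γ ≅ proj₂ (joinAll gs)))))
theorem3p1 Γ simple (_ , diam≤2 , _) = mk⇔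
  (nonAdjacentEqualDegree⇒joinOfRegular Γ simple ∘ Equivalence.to balanced⇔equal)
  (λ (gs , regular , Γ≅gs) → Equivalence.from balanced⇔equal
     (≅-nonAdjacentEqualDegree Γ≅gs (joinAll-nonAdjacentEqualDegree gs regular)))
  where
  balanced⇔equal = twoDistanceBalanced⇔nonAdjacentEqualDegree Γ simple diam≤2
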